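{- For every positive integer $k$, the maximum cardinality of an avoidable subset of $\overline{S_k}$ is $k!-k$.
   Context: A totally vincular pattern of length $k$, written $\overline{\pi}$ for $\pi\in S_k$, is the pattern $\pi$ with all $k$ entries required to be consecutive; $\overline{S_k}$ is the set of all of them. A cyclic permutation $[\sigma]$ of length $n$ (the set of all rotations of $\sigma\in S_n$) contains $\overline{\pi}$ if some $k$ cyclically consecutive entries (indices mod $n$, $n\ge k$) are order-isomorphic to $\pi$; otherwise it avoids it. $\mathrm{Av}_n[\Pi]$ is the set of cyclic permutations of length $n$ avoiding every pattern in $\Pi$. A set $\Pi\subseteq\overline{S_k}$ is unavoidable if $|\mathrm{Av}_n[\Pi]|=0$ for all sufficiently large $n$, and avoidable otherwise. -}

module Defs where

open import Data.Nat using (ℕ; zero; suc; _+_; _≤_; _<_; NonZero)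
open import Data.Nat.DivMod using (_mod_)
open import Data.Fin using (Fin; toℕ)
open import Data.Vec using (Vec; lookup)
open import Data.List using (List)
open import Data.List.Relation.Unary.All using (All)
open import Data.List.Relation.Unary.Unique.Propositional using (Unique)
open import Data.Product using (Σ; ∃; _×_)
open import Relation.Nullary using (¬_)
open import Relation.Binary.PropositionalEquality using (_≡_)
open import Function.Bundles using (_⇔_)

-- A permutation of length n in one-line notation: σ(i) = lookup σ i,
-- values in {0,…,n-1}, with all entries distinct.
IsPerm : ∀ {n} → Vec (Fin n) n → Set
IsPerm {n} v = ∀ (i j : Fin n) → lookup v i ≡ lookup v j → i ≡ j

OccursAt : ∀ {k n} .{{_ : NonZero n}} → Vec (Fin k) k → Vec (Fin n) n → Fin n → Set
OccursAt {k} {n} π σ i =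
  ∀ (a b : Fin k) →
    (toℕ (lookup π a) < toℕ (lookup π b)) ⇔
    (toℕ (lookup σ ((toℕ i + toℕ a) mod n)) < toℕ (lookup σ ((toℕ i + toℕ b) mod n)))

-- The cyclic permutation [σ] contains the totally vincular pattern π̄.
-- (This is invariant under rotation of σ, so it is a property of [σ].)
CycContains : ∀ {k n} .{{_ : NonZero n}} → Vec (Fin n) n → Vec (Fin k) k → Set
CycContains σ π = ∃ λ i → OccursAt π σ i

CycAvoidsAll : ∀ {k n} .{{_ : NonZero n}} → Vec (Fin n) n → List (Vec (Fin k) k) → Set
CycAvoidsAll σ Π = All (λ π → ¬ CycContains σ π) Π

-- A subset Π of S̄_k, given as a duplicate-free list of permutations of length k;
-- its cardinality is its length.
IsPatternSet : ∀ k → List (Vec (Fin k) k) → Set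
IsPatternSet k Π = All IsPerm Π × Unique Π

-- Π is unavoidable: for all sufficiently large n (n ≥ k), Av_n[Π] is empty,
-- i.e. no cyclic permutation of length n avoids all of Π.
-- Lengths n ≥ 1 are written n = suc m.
Unavoidable : ∀ k → List (Vec (Fin k) k) → Set
Unavoidable k Π =
  ∃ λ (N : ℕ) → ∀ (m : ℕ) → N ≤ suc m → k ≤ suc m →
    (σ : Vec (Fin (suc m)) (suc m)) → IsPerm σ → ¬ CycAvoidsAll σ Π

Avoidable : ∀ k → List (Vec (Fin k) k) → Set
Avoidable k Π = ¬ Unavoidable k Π

-- Every cyclic permutation of length n ≥ k contains k distinct consecutive patterns: the k
-- windows passing through the position of its largest entry have their maxima at k different
-- offsets. Hence an avoidable set misses at least k patterns and has at most k! − k elements.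
-- Conversely, every window of the identity permutation of length n ≥ k is order-isomorphic to
-- one of the k rotations of 12…k, so the set of all other patterns is avoidable; it has exactly
-- k! − k elements.
module Submission where

open import Data.Empty using (⊥)
open import Data.Fin as F using (Fin; toℕ; punchIn; punchOut; fromℕ<)
import Data.Fin.Properties as F
open import Data.List as L using (List; []; _∷_; length; filter; _++_; cartesianProductWith; allFin)
open import Data.List.Extrema.Nat using (argmax; f[xs]≤f[argmax])
import Data.List.Membership.DecPropositional as DecMembership
open import Data.List.Membership.Propositional using (_∈_)
open import Data.List.Membership.Propositional.Properties
  using (∈-filter⁺; ∈-filter⁻; ∈-++⁺ˡ; ∈-++⁺ʳ; ∈-++⁻; ∈-allFin; ∈-tabulate⁺
        ; ∈-cartesianProductWith⁺; ∈-cartesianProductWith⁻)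
open import Data.List.Properties using (filter-notAll; length-++; length-map; length-tabulate)
open import Data.List.Relation.Binary.Subset.Propositional using (_⊆_)
open import Data.List.Relation.Unary.All as All using (All; []; _∷_)
import Data.List.Relation.Unary.All.Properties as All
open import Data.List.Relation.Unary.AllPairs using ([]; _∷_)
open import Data.List.Relation.Unary.Any as Any using (here; there)
open import Data.List.Relation.Unary.Unique.Propositional using (Unique)
open import Data.List.Relation.Unary.Unique.Propositional.Properties
  using (cartesianProductWith⁺; allFin⁺; tabulate⁺; ++⁺; filter⁺)
open import Data.Nat using (ℕ; zero; suc; _+_; _*_; _∸_; _≤_; _<_; _≥_; z≤n; _!; NonZero; _<?_; _≤?_)
open import Data.Nat.DivMod using (_%_; _mod_; %-distribˡ-+; m%n%n≡m%n; [m+n]%n≡m%n; m<n⇒m%n≡m)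
open import Data.Nat.Induction using (<-rec)
open import Data.Nat.Properties
open import Data.Product using (∃; _×_; _,_; proj₁; proj₂)
open import Data.Sum using ([_,_]′)
open import Data.Vec as V using (Vec; _∷_; lookup; tabulate)
open import Data.Vec.Properties
  using (lookup∘tabulate; tabulate∘lookup; tabulate-cong; tabulate-∘; lookup-map; ∷-injective; ≡-dec; lookup-allFin)
open import Data.Vec.Relation.Binary.Pointwise.Extensional using (ext; Pointwise-≡⇒≡)
open import Function.Base using (_∘_)
open import Function.Bundles using (_⇔_; Equivalence; mk⇔)
import Function.Properties.Equivalence as ⇔
open import Relation.Binary.Definitions using (DecidableEquality; tri<; tri≈; tri>)
open import Relation.Binary.PropositionalEquality
  using (_≡_; _≢_; refl; sym; trans; cong; cong₂; subst; subst₂; module ≡-Reasoning)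
open import Relation.Nullary using (¬_; yes; no; ¬?; contradiction)
open import Relation.Nullary.Decidable using (decidable-stable)
open import Algebra.Properties.CommutativeSemigroup +-commutativeSemigroup using (x∙yz≈y∙xz)

open import Defs

module _ {A : Set} (_≟_ : DecidableEquality A) where
  open DecMembership _≟_ using (_∈?_; _∉?_)

  Unique-⊆⇒length≤ : ∀ {xs ys : List A} → Unique xs → xs ⊆ ys → length xs ≤ length ys
  Unique-⊆⇒length≤ {[]}     _             _     = z≤n
  Unique-⊆⇒length≤ {x ∷ xs} {ys} (x∉xs ∷ xs!) xs⊆ys = begin-strict
    length xs        ≤⟨ Unique-⊆⇒length≤ xs! xs⊆ys-x ⟩
    length ys-x      <⟨ filter-notAll _ ys (Any.map (λ x≡y y≢x → y≢x (sym x≡y)) (xs⊆ys (here refl))) ⟩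
    length ys        ∎
    where
      open ≤-Reasoning
      ys-x = filter (λ y → ¬? (y ≟ x)) ys
      xs⊆ys-x : xs ⊆ ys-x
      xs⊆ys-x y∈xs = ∈-filter⁺ _ (xs⊆ys (there y∈xs)) (λ y≡x → All.lookup x∉xs y∈xs (sym y≡x))

  length-filter-∉+length : ∀ {xs ys : List A} → Unique xs → Unique ys → ys ⊆ xs →
                           length (filter (_∉? ys) xs) + length ys ≡ length xs
  length-filter-∉+length {xs} {ys} xs! ys! ys⊆xs = ≤-antisym
    (subst (_≤ length xs) (length-++ rest) (Unique-⊆⇒length≤ (++⁺ (filter⁺ _ xs!) ys! disjoint) rest++ys⊆xs))
    (subst (length xs ≤_) (length-++ rest) (Unique-⊆⇒length≤ xs! xs⊆rest++ys))
    where
      rest = filter (_∉? ys) xs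
      disjoint : ∀ {v} → v ∈ rest × v ∈ ys → ⊥
      disjoint (v∈rest , v∈ys) = proj₂ (∈-filter⁻ (_∉? ys) {xs = xs} v∈rest) v∈ys
      rest++ys⊆xs : rest ++ ys ⊆ xs
      rest++ys⊆xs v∈ = [ (λ v∈rest → proj₁ (∈-filter⁻ (_∉? ys) {xs = xs} v∈rest)) , ys⊆xs ]′ (∈-++⁻ rest v∈)
      xs⊆rest++ys : xs ⊆ rest ++ ys
      xs⊆rest++ys {v} v∈xs with v ∈? ys
      ... | yes v∈ys = ∈-++⁺ʳ rest v∈ys
      ... | no  v∉ys = ∈-++⁺ˡ (∈-filter⁺ (_∉? ys) v∈xs v∉ys)

length-cartesianProductWith : ∀ {A B C : Set} (f : A → B → C) xs ys →
                              length (cartesianProductWith f xs ys) ≡ length xs * length ys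
length-cartesianProductWith f []       ys = refl
length-cartesianProductWith f (x ∷ xs) ys = begin
  length (L.map (f x) ys ++ cartesianProductWith f xs ys)         ≡⟨ length-++ (L.map (f x) ys) ⟩
  length (L.map (f x) ys) + length (cartesianProductWith f xs ys) ≡⟨ cong₂ _+_ (length-map (f x) ys)
                                                                       (length-cartesianProductWith f xs ys) ⟩
  length ys + length xs * length ys                               ∎
  where open ≡-Reasoning

-- Enumerating permutations

Vec-map-injective : ∀ {A B : Set} {n} {f : A → B} → (∀ {x y} → f x ≡ f y → x ≡ y) →
                    ∀ {u v : Vec A n} → V.map f u ≡ V.map f v → u ≡ v
Vec-map-injective f-inj {V.[]}  {V.[]}  _  = refl
Vec-map-injective f-inj {x ∷ u} {y ∷ v} eq with ∷-injective eq
... | fx≡fy , fu≡fv = cong₂ _∷_ (f-inj fx≡fy) (Vec-map-injective f-inj fu≡fv)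

Perm : ℕ → Set
Perm k = Vec (Fin k) k

_≟ₚ_ : ∀ {k} → DecidableEquality (Perm k)
_≟ₚ_ = ≡-dec F._≟_

prepend : ∀ {k} → Fin (suc k) → Perm k → Perm (suc k)
prepend j p = j ∷ V.map (punchIn j) p

prepend-injective : ∀ {k} {i j : Fin (suc k)} {p q : Perm k} → prepend i p ≡ prepend j q → i ≡ j × p ≡ q
prepend-injective {i = i} eq with ∷-injective eq
... | refl , tail≡ = refl , Vec-map-injective (F.punchIn-injective i _ _) tail≡

prepend-isPerm : ∀ {k} j {p : Perm k} → IsPerm p → IsPerm (prepend j p)
prepend-isPerm j {p} p-perm F.zero    F.zero    _  = refl
prepend-isPerm j {p} p-perm F.zero    (F.suc b) eq =
  contradiction (sym (trans eq (lookup-map b (punchIn j) p))) (F.punchInᵢ≢i j _)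
prepend-isPerm j {p} p-perm (F.suc a) F.zero    eq =
  contradiction (trans (sym (lookup-map a (punchIn j) p)) eq) (F.punchInᵢ≢i j _)
prepend-isPerm j {p} p-perm (F.suc a) (F.suc b) eq = cong F.suc (p-perm a b (F.punchIn-injective j _ _
  (trans (sym (lookup-map a (punchIn j) p)) (trans eq (lookup-map b (punchIn j) p)))))

permutations : ∀ k → List (Perm k)
permutations zero    = V.[] ∷ []
permutations (suc k) = cartesianProductWith prepend (allFin (suc k)) (permutations k)

length-permutations : ∀ k → length (permutations k) ≡ k !
length-permutations zero    = refl
length-permutations (suc k) = trans (length-cartesianProductWith prepend (allFin (suc k)) (permutations k))
  (cong₂ _*_ (length-tabulate {n = suc k} (λ j → j)) (length-permutations k))

permutations-unique : ∀ k → Unique (permutations k)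
permutations-unique zero    = [] ∷ []
permutations-unique (suc k) =
  cartesianProductWith⁺ prepend prepend-injective (allFin⁺ (suc k)) (permutations-unique k)

∈-permutations⁻ : ∀ k {v : Perm k} → v ∈ permutations k → IsPerm v
∈-permutations⁻ zero    (here refl) ()
∈-permutations⁻ (suc k) v∈ with ∈-cartesianProductWith⁻ prepend (allFin (suc k)) (permutations k) v∈
... | j , p , _ , p∈ , refl = prepend-isPerm j (∈-permutations⁻ k p∈)

∈-permutations⁺ : ∀ k {v : Perm k} → IsPerm v → v ∈ permutations k
∈-permutations⁺ zero    {V.[]}  _      = here refl
∈-permutations⁺ (suc k) {j ∷ w} v-perm =
  subst (_∈ permutations (suc k)) prepend-j-p≡j∷w
    (∈-cartesianProductWith⁺ prepend (∈-allFin j) (∈-permutations⁺ k p-perm))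
  where
    j≢w : ∀ a → j ≢ lookup w a
    j≢w a = F.0≢1+n ∘ v-perm F.zero (F.suc a)
    p : Perm k
    p = tabulate (λ a → punchOut (j≢w a))
    p-perm : IsPerm p
    p-perm a b eq = F.suc-injective (v-perm (F.suc a) (F.suc b) (F.punchOut-injective (j≢w a) (j≢w b)
      (trans (sym (lookup∘tabulate _ a)) (trans eq (lookup∘tabulate _ b)))))
    prepend-j-p≡j∷w : prepend j p ≡ j ∷ w
    prepend-j-p≡j∷w = cong (j ∷_) (begin
      V.map (punchIn j) (tabulate (λ a → punchOut (j≢w a))) ≡⟨ tabulate-∘ (punchIn j) _ ⟨
      tabulate (λ a → punchIn j (punchOut (j≢w a)))         ≡⟨ tabulate-cong (λ a → F.punchIn-punchOut (j≢w a)) ⟩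
      tabulate (lookup w)                                    ≡⟨ tabulate∘lookup w ⟩
      w                                                      ∎)
      where open ≡-Reasoning

IsPerm⇒surjective : ∀ {k} (v : Perm k) → IsPerm v → ∀ y → ∃ λ a → lookup v a ≡ y
IsPerm⇒surjective {suc k} v v-perm y with F.any? (λ a → lookup v a F.≟ y)
... | yes hit = hit
... | no miss = contradiction (F.injective⇒≤ punchOut-injective) 1+n≰n
  where
    y≢v : ∀ a → y ≢ lookup v a
    y≢v a y≡va = miss (a , sym y≡va)
    punchOut-injective : ∀ {a b} → punchOut (y≢v a) ≡ punchOut (y≢v b) → a ≡ b
    punchOut-injective eq = v-perm _ _ (F.punchOut-injective (y≢v _) (y≢v _) eq)

values : ∀ {m n} → Vec (Fin n) m → Fin m → ℕ
values v a = toℕ (lookup v a)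

OrderIsomorphic : ∀ {k} → (Fin k → ℕ) → (Fin k → ℕ) → Set
OrderIsomorphic {k} x y = ∀ (a b : Fin k) → (x a < x b) ⇔ (y a < y b)

≡⇒<⇔< : ∀ {m m′ n n′} → m ≡ m′ → n ≡ n′ → (m < n) ⇔ (m′ < n′)
≡⇒<⇔< refl refl = ⇔.refl

≅-sym : ∀ {k} {x y : Fin k → ℕ} → OrderIsomorphic x y → OrderIsomorphic y x
≅-sym x≅y a b = ⇔.sym (x≅y a b)

≅-trans : ∀ {k} {x y z : Fin k → ℕ} → OrderIsomorphic x y → OrderIsomorphic y z → OrderIsomorphic x z
≅-trans x≅y y≅z a b = ⇔.trans (x≅y a b) (y≅z a b)

-- Strong induction on π a: if τ a > π a, the τ-preimage c of π a has π c < π a, against the hypothesis for c.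
isomorphic-values-≤ : ∀ {k} (π τ : Perm k) → IsPerm τ → OrderIsomorphic (values π) (values τ) →
                      ∀ a → values τ a ≤ values π a
isomorphic-values-≤ π τ τ-perm π≅τ a = <-rec P step (values π a) a refl
  where
    P : ℕ → Set
    P v = ∀ a → values π a ≡ v → values τ a ≤ v
    step : ∀ v → (∀ {u} → u < v → P u) → P v
    step _ ih a refl with values τ a ≤? values π a
    ... | yes τa≤πa = τa≤πa
    ... | no  τa≰πa = contradiction (ih πc<πa c refl) (<⇒≱ (subst (values π c <_) (sym τc≡πa) πc<πa))
      where
        c = proj₁ (IsPerm⇒surjective τ τ-perm (lookup π a))
        τc≡πa : values τ c ≡ values π a
        τc≡πa = cong toℕ (proj₂ (IsPerm⇒surjective τ τ-perm (lookup π a)))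
        πc<πa : values π c < values π a
        πc<πa = Equivalence.from (π≅τ c a) (subst (_< values τ a) (sym τc≡πa) (≰⇒> τa≰πa))

isomorphic-perms-≡ : ∀ {k} (π τ : Perm k) → IsPerm π → IsPerm τ →
                     OrderIsomorphic (values π) (values τ) → π ≡ τ
isomorphic-perms-≡ π τ π-perm τ-perm π≅τ = Pointwise-≡⇒≡ (ext λ a → F.toℕ-injective (≤-antisym
  (isomorphic-values-≤ τ π π-perm (≅-sym {x = values π} π≅τ) a)
  (isomorphic-values-≤ π τ τ-perm π≅τ a)))

module _ {k} (x : Fin k → ℕ) where

  below : ℕ → List (Fin k)
  below v = filter (λ b → x b <? v) (allFin k)

  rank : Fin k → ℕ
  rank a = length (below (x a))

  rank<k : ∀ a → rank a < k
  rank<k a = subst (rank a <_) (length-tabulate {n = k} (λ b → b))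
    (filter-notAll _ (allFin k) (Any.map (λ { refl → <-irrefl refl }) (∈-allFin a)))

  rank-mono-< : ∀ {a c} → x a < x c → rank a < rank c
  rank-mono-< {a} {c} xa<xc = Unique-⊆⇒length≤ F._≟_ (a∉below ∷ filter⁺ _ (allFin⁺ k)) a∷below⊆below-c
    where
      a∉below : All (a ≢_) (below (x a))
      a∉below = All.tabulate λ b∈ → λ { refl → <-irrefl refl (proj₂ (∈-filter⁻ _ {xs = allFin k} b∈)) }
      a∷below⊆below-c : a ∷ below (x a) ⊆ below (x c)
      a∷below⊆below-c (here refl) = ∈-filter⁺ _ (∈-allFin a) xa<xc
      a∷below⊆below-c (there b∈) =
        ∈-filter⁺ _ (∈-allFin _) (<-trans (proj₂ (∈-filter⁻ _ {xs = allFin k} b∈)) xa<xc)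

  rank-reflects-< : ∀ {a c} → rank a < rank c → x a < x c
  rank-reflects-< {a} {c} ra<rc with <-cmp (x a) (x c)
  ... | tri< xa<xc _ _ = xa<xc
  ... | tri≈ _ xa≡xc _ = contradiction (cong (λ v → length (below v)) xa≡xc) (<⇒≢ ra<rc)
  ... | tri> _ _ xc<xa = contradiction (rank-mono-< xc<xa) (<-asym ra<rc)

  rank-injective : (∀ a c → x a ≡ x c → a ≡ c) → ∀ {a c} → rank a ≡ rank c → a ≡ c
  rank-injective x-injective {a} {c} ra≡rc with <-cmp (x a) (x c)
  ... | tri< xa<xc _ _ = contradiction (rank-mono-< xa<xc) (<-irrefl ra≡rc)
  ... | tri≈ _ xa≡xc _ = x-injective a c xa≡xc
  ... | tri> _ _ xc<xa = contradiction (rank-mono-< xc<xa) (<-irrefl (sym ra≡rc))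

  standardize : Perm k
  standardize = tabulate (λ a → fromℕ< (rank<k a))

  values-standardize : ∀ a → values standardize a ≡ rank a
  values-standardize a = trans (cong toℕ (lookup∘tabulate _ a)) (F.toℕ-fromℕ< (rank<k a))

  standardize-≅ : OrderIsomorphic (values standardize) x
  standardize-≅ a b =
    ⇔.trans (≡⇒<⇔< (values-standardize a) (values-standardize b)) (mk⇔ rank-reflects-< rank-mono-<)

  standardize-isPerm : (∀ a c → x a ≡ x c → a ≡ c) → IsPerm standardize
  standardize-isPerm x-injective a c eq = rank-injective x-injective
    (trans (sym (values-standardize a)) (trans (cong toℕ eq) (values-standardize c)))

module _ {N c : ℕ} .{{_ : NonZero N}} (c≤N : c ≤ N) where

  %-shift-low : ∀ {a} → a < N ∸ c → (c + a) % N ≡ c + a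
  %-shift-low {a} a<N∸c = m<n⇒m%n≡m (subst (_< N) (+-comm a c) (m≤o∸n⇒m+n≤o (suc a) c≤N a<N∸c))

  %-shift-high : ∀ {a} → N ∸ c ≤ a → a < N → (c + a) % N ≡ a ∸ (N ∸ c)
  %-shift-high {a} N∸c≤a a<N = begin
    (c + a) % N             ≡⟨ cong (λ v → (c + v) % N) (m∸n+n≡m N∸c≤a) ⟨
    (c + (a ∸ t + t)) % N   ≡⟨ cong (_% N) (x∙yz≈y∙xz c (a ∸ t) t) ⟩
    (a ∸ t + (c + t)) % N   ≡⟨ cong (λ v → (a ∸ t + v) % N) (m+[n∸m]≡n c≤N) ⟩
    (a ∸ t + N) % N         ≡⟨ [m+n]%n≡m%n (a ∸ t) N ⟩
    (a ∸ t) % N             ≡⟨ m<n⇒m%n≡m (≤-<-trans (m∸n≤m a t) a<N) ⟩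
    a ∸ t                   ∎
    where
      open ≡-Reasoning
      t = N ∸ c

  ∸-wrap<c : ∀ {a} → N ∸ c ≤ a → a < N → a ∸ (N ∸ c) < c
  ∸-wrap<c {a} N∸c≤a a<N = subst (a ∸ (N ∸ c) <_) (m∸[m∸n]≡n c≤N) (∸-monoˡ-< a<N N∸c≤a)

  %-shift-cancel : ∀ {a} → a < N → ((c + a) % N + (N ∸ c)) % N ≡ a
  %-shift-cancel {a} a<N = begin
    ((c + a) % N + (N ∸ c)) % N         ≡⟨ %-distribˡ-+ ((c + a) % N) (N ∸ c) N ⟩
    ((c + a) % N % N + (N ∸ c) % N) % N ≡⟨ cong (λ v → (v + (N ∸ c) % N) % N) (m%n%n≡m%n (c + a) N) ⟩
    ((c + a) % N + (N ∸ c) % N) % N     ≡⟨ %-distribˡ-+ (c + a) (N ∸ c) N ⟨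
    (c + a + (N ∸ c)) % N               ≡⟨ cong (_% N) (trans (+-assoc c a _) (x∙yz≈y∙xz c a (N ∸ c))) ⟩
    (a + (c + (N ∸ c))) % N             ≡⟨ cong (λ v → (a + v) % N) (m+[n∸m]≡n c≤N) ⟩
    (a + N) % N                         ≡⟨ [m+n]%n≡m%n a N ⟩
    a % N                               ≡⟨ m<n⇒m%n≡m a<N ⟩
    a                                   ∎
    where open ≡-Reasoning

  %-shift-injective : ∀ {a b} → a < N → b < N → (c + a) % N ≡ (c + b) % N → a ≡ b
  %-shift-injective {a} {b} a<N b<N eq = begin
    a                               ≡⟨ %-shift-cancel a<N ⟨
    ((c + a) % N + (N ∸ c)) % N     ≡⟨ cong (λ v → (v + (N ∸ c)) % N) eq ⟩
    ((c + b) % N + (N ∸ c)) % N     ≡⟨ %-shift-cancel b<N ⟩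
    b                               ∎
    where open ≡-Reasoning

-- Below the wrap point N ∸ c the shift adds c, from it on it subtracts N ∸ c and lands below c; so the
-- relative order of two shifted entries depends only on the sides of the wrap point they lie on.
module _ {K N N′ c c′ : ℕ} .{{_ : NonZero N}} .{{_ : NonZero N′}}
         (K≤N : K ≤ N) (K≤N′ : K ≤ N′) (c≤N : c ≤ N) (c′≤N′ : c′ ≤ N′)
         (same-wrap : ∀ {x} → x < K → (x < N ∸ c) ⇔ (x < N′ ∸ c′)) where

  private
    low : ∀ {x} → x < N ∸ c → (c + x) % N ≡ c + x
    low = %-shift-low c≤N

    low′ : ∀ {x} → x < K → x < N ∸ c → (c′ + x) % N′ ≡ c′ + x
    low′ x<K = %-shift-low c′≤N′ ∘ Equivalence.to (same-wrap x<K)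

    wraps′ : ∀ {x} → x < K → ¬ x < N ∸ c → N′ ∸ c′ ≤ x
    wraps′ x<K x-high = ≮⇒≥ (x-high ∘ Equivalence.from (same-wrap x<K))

    high : ∀ {x} → x < K → ¬ x < N ∸ c → (c + x) % N ≡ x ∸ (N ∸ c)
    high x<K x-high = %-shift-high c≤N (≮⇒≥ x-high) (<-≤-trans x<K K≤N)

    high′ : ∀ {x} → x < K → ¬ x < N ∸ c → (c′ + x) % N′ ≡ x ∸ (N′ ∸ c′)
    high′ x<K x-high = %-shift-high c′≤N′ (wraps′ x<K x-high) (<-≤-trans x<K K≤N′)

    high<c : ∀ {x} → x < K → ¬ x < N ∸ c → x ∸ (N ∸ c) < c
    high<c x<K x-high = ∸-wrap<c c≤N (≮⇒≥ x-high) (<-≤-trans x<K K≤N)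

    high<c′ : ∀ {x} → x < K → ¬ x < N ∸ c → x ∸ (N′ ∸ c′) < c′
    high<c′ x<K x-high = ∸-wrap<c c′≤N′ (wraps′ x<K x-high) (<-≤-trans x<K K≤N′)

  %-shift-<-transfer : ∀ {a b} → a < K → b < K → (c + a) % N < (c + b) % N → (c′ + a) % N′ < (c′ + b) % N′
  %-shift-<-transfer {a} {b} a<K b<K lt with a <? N ∸ c | b <? N ∸ c
  ... | yes a-low | yes b-low = subst₂ _<_ (sym (low′ a<K a-low)) (sym (low′ b<K b-low))
    (+-monoʳ-< c′ (+-cancelˡ-< c a b (subst₂ _<_ (low a-low) (low b-low) lt)))
  ... | no a-high | no b-high = subst₂ _<_ (sym (high′ a<K a-high)) (sym (high′ b<K b-high))
    (∸-monoˡ-< a<b (wraps′ a<K a-high))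
    where
      a<b : a < b
      a<b = ≰⇒> λ b≤a → <⇒≱ (subst₂ _<_ (high a<K a-high) (high b<K b-high) lt) (∸-monoˡ-≤ (N ∸ c) b≤a)
  ... | yes a-low | no b-high = contradiction lt (<-asym (begin-strict
    (c + b) % N     ≡⟨ high b<K b-high ⟩
    b ∸ (N ∸ c)     <⟨ high<c b<K b-high ⟩
    c               ≤⟨ m≤m+n c a ⟩
    c + a           ≡⟨ low a-low ⟨
    (c + a) % N     ∎))
    where open ≤-Reasoning
  ... | no a-high | yes b-low = begin-strict
    (c′ + a) % N′   ≡⟨ high′ a<K a-high ⟩
    a ∸ (N′ ∸ c′)   <⟨ high<c′ a<K a-high ⟩
    c′              ≤⟨ m≤m+n c′ b ⟩
    c′ + b          ≡⟨ low′ b<K b-low ⟨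
    (c′ + b) % N′   ∎
    where open ≤-Reasoning

%-shift-≅ : ∀ {K N N′ c c′ : ℕ} .{{_ : NonZero N}} .{{_ : NonZero N′}} →
            K ≤ N → K ≤ N′ → c ≤ N → c′ ≤ N′ → (∀ {x} → x < K → (x < N ∸ c) ⇔ (x < N′ ∸ c′)) →
            ∀ {a b} → a < K → b < K → ((c + a) % N < (c + b) % N) ⇔ ((c′ + a) % N′ < (c′ + b) % N′)
%-shift-≅ K≤N K≤N′ c≤N c′≤N′ same-wrap a<K b<K = mk⇔
  (%-shift-<-transfer K≤N K≤N′ c≤N c′≤N′ same-wrap a<K b<K)
  (%-shift-<-transfer K≤N′ K≤N c′≤N′ c≤N (⇔.sym ∘ same-wrap) a<K b<K)

position : ∀ {n k} .{{_ : NonZero n}} → Fin n → Fin k → Fin n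
position {n} i a = (toℕ i + toℕ a) mod n

toℕ-position : ∀ {n k} .{{_ : NonZero n}} (i : Fin n) (a : Fin k) → toℕ (position i a) ≡ (toℕ i + toℕ a) % n
toℕ-position i a = F.toℕ-fromℕ< _

position-injective : ∀ {n k} .{{_ : NonZero n}} → k ≤ n → ∀ (i : Fin n) {a b : Fin k} →
                     position i a ≡ position i b → a ≡ b
position-injective k≤n i {a} {b} eq = F.toℕ-injective (%-shift-injective (<⇒≤ (F.toℕ<n i))
  (<-≤-trans (F.toℕ<n a) k≤n) (<-≤-trans (F.toℕ<n b) k≤n)
  (trans (sym (toℕ-position i a)) (trans (cong toℕ eq) (toℕ-position i b))))

module _ {n : ℕ} .{{_ : NonZero n}} (σ : Perm n) where

  window : ∀ {k} → Fin n → Fin k → ℕ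
  window i a = values σ (position i a)

  windowPattern : ∀ {k} → Fin n → Perm k
  windowPattern i = standardize (window i)

  window-injective : IsPerm σ → ∀ {k} → k ≤ n → ∀ i (a b : Fin k) → window i a ≡ window i b → a ≡ b
  window-injective σ-perm k≤n i a b eq = position-injective k≤n i (σ-perm _ _ (F.toℕ-injective eq))

  windowPattern-isPerm : IsPerm σ → ∀ {k} → k ≤ n → ∀ i → IsPerm (windowPattern {k} i)
  windowPattern-isPerm σ-perm k≤n i = standardize-isPerm (window i) (window-injective σ-perm k≤n i)

  contains-windowPattern : ∀ {k} i → CycContains σ (windowPattern {k} i)
  contains-windowPattern i = i , standardize-≅ (window i)

-- The upper bound

maximumPosition : ∀ {m} (σ : Perm (suc m)) → IsPerm σ → ∃ λ p → ∀ q → q ≢ p → values σ q < values σ p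
maximumPosition {m} σ σ-perm = p , λ q q≢p → ≤∧≢⇒<
  (All.lookup (f[xs]≤f[argmax] {f = values σ} F.zero (allFin (suc m))) (∈-allFin q))
  (λ eq → q≢p (σ-perm _ _ (F.toℕ-injective eq)))
  where p = argmax (values σ) F.zero (allFin (suc m))

module _ {n k : ℕ} .{{_ : NonZero n}} (σ : Perm n) (k≤n : k ≤ n) (maxPosition : Fin n)
         (values-<-max : ∀ q → q ≢ maxPosition → values σ q < values σ maxPosition) where

  maxWindowStart : Fin k → Fin n
  maxWindowStart j = (n ∸ toℕ j + toℕ maxPosition) mod n

  position-maxWindowStart : ∀ j → position (maxWindowStart j) j ≡ maxPosition
  position-maxWindowStart j = F.toℕ-injective (begin
    toℕ (position (maxWindowStart j) j)         ≡⟨ toℕ-position (maxWindowStart j) j ⟩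
    (toℕ (maxWindowStart j) + toℕ j) % n        ≡⟨ cong (λ v → (v + toℕ j) % n) (F.toℕ-fromℕ< _) ⟩
    ((n ∸ toℕ j + p) % n + toℕ j) % n           ≡⟨ cong (λ v → ((n ∸ toℕ j + p) % n + v) % n) (m∸[m∸n]≡n j≤n) ⟨
    ((n ∸ toℕ j + p) % n + (n ∸ (n ∸ toℕ j))) % n ≡⟨ %-shift-cancel (m∸n≤m n (toℕ j)) (F.toℕ<n maxPosition) ⟩
    p                                           ∎)
    where
      open ≡-Reasoning
      p = toℕ maxPosition
      j≤n = <⇒≤ (<-≤-trans (F.toℕ<n j) k≤n)

  maxWindowPattern : Fin k → Perm k
  maxWindowPattern j = windowPattern σ (maxWindowStart j)

  maxWindowPattern-max : ∀ j a → a ≢ j → values (maxWindowPattern j) a < values (maxWindowPattern j) j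
  maxWindowPattern-max j a a≢j = Equivalence.from (standardize-≅ (window σ (maxWindowStart j)) a j)
    (subst (λ q → values σ (position (maxWindowStart j) a) < values σ q) (sym (position-maxWindowStart j))
      (values-<-max _ λ eq → a≢j (position-injective k≤n _ (trans eq (sym (position-maxWindowStart j))))))

  maxWindowPattern-injective : ∀ {j l} → maxWindowPattern j ≡ maxWindowPattern l → j ≡ l
  maxWindowPattern-injective {j} {l} eq = decidable-stable (j F.≟ l) λ j≢l →
    <-asym (maxWindowPattern-max j l (j≢l ∘ sym))
           (subst (λ π → values π j < values π l) (sym eq) (maxWindowPattern-max l j j≢l))

avoider⇒length+k≤k! : ∀ {m k} (σ : Perm (suc m)) → IsPerm σ → k ≤ suc m →
                      ∀ {Π} → IsPatternSet k Π → CycAvoidsAll σ Π → length Π + k ≤ k !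
avoider⇒length+k≤k! {m} {k} σ σ-perm k≤n {Π} (Π-perms , Π!) σ-avoids =
  subst₂ _≤_ (trans (length-++ Π) (cong (length Π +_) (length-tabulate W))) (length-permutations k)
    (Unique-⊆⇒length≤ _≟ₚ_ (++⁺ Π! (tabulate⁺ (maxWindowPattern-injective σ k≤n p p-max)) disjoint)
      (∈-permutations⁺ k ∘ All.lookup (All.++⁺ Π-perms Ws-perms)))
  where
    p = proj₁ (maximumPosition σ σ-perm)
    p-max = proj₂ (maximumPosition σ σ-perm)
    start : Fin k → Fin (suc m)
    start = maxWindowStart σ k≤n p p-max
    W : Fin k → Perm k
    W = maxWindowPattern σ k≤n p p-max
    Ws-perms : All IsPerm (L.tabulate W)
    Ws-perms = All.tabulate⁺ (windowPattern-isPerm σ σ-perm k≤n ∘ start)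
    Ws-contained : All (CycContains σ) (L.tabulate W)
    Ws-contained = All.tabulate⁺ (contains-windowPattern σ ∘ start)
    disjoint : ∀ {π} → π ∈ Π × π ∈ L.tabulate W → ⊥
    disjoint (π∈Π , π∈Ws) = All.lookup σ-avoids π∈Π (All.lookup Ws-contained π∈Ws)

Avoidable⇒length≤k!∸k : ∀ {k Π} → IsPatternSet k Π → Avoidable k Π → length Π ≤ k ! ∸ k
Avoidable⇒length≤k!∸k {k} {Π} Π-set Π-avoidable = ≮⇒≥ λ k!∸k<|Π| →
  Π-avoidable (0 , λ m _ k≤n σ σ-perm σ-avoids →
    <⇒≱ k!∸k<|Π| (m+n≤o⇒m≤o∸n (length Π) (avoider⇒length+k≤k! σ σ-perm k≤n Π-set σ-avoids)))

-- The lower bound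

identity : ∀ n → Perm n
identity n = V.allFin n

identity-isPerm : ∀ n → IsPerm (identity n)
identity-isPerm n a b eq = trans (sym (lookup-allFin a)) (trans eq (lookup-allFin b))

rotation : ∀ {k} → Fin (suc k) → Perm (suc k)
rotation r = tabulate (position r)

values-rotation : ∀ {k} (r a : Fin (suc k)) → values (rotation r) a ≡ (toℕ r + toℕ a) % suc k
values-rotation r a = trans (cong toℕ (lookup∘tabulate (position r) a)) (toℕ-position r a)

values-rotation-zero : ∀ {k} (r : Fin (suc k)) → values (rotation r) F.zero ≡ toℕ r
values-rotation-zero {k} r = begin
  values (rotation r) F.zero  ≡⟨ values-rotation r F.zero ⟩
  (toℕ r + 0) % suc k         ≡⟨ cong (_% suc k) (+-identityʳ (toℕ r)) ⟩
  toℕ r % suc k               ≡⟨ m<n⇒m%n≡m (F.toℕ<n r) ⟩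
  toℕ r                       ∎
  where open ≡-Reasoning

rotation-isPerm : ∀ {k} (r : Fin (suc k)) → IsPerm (rotation r)
rotation-isPerm r a b eq = position-injective ≤-refl r
  (trans (sym (lookup∘tabulate (position r) a)) (trans eq (lookup∘tabulate (position r) b)))

rotation-injective : ∀ {k} {r s : Fin (suc k)} → rotation r ≡ rotation s → r ≡ s
rotation-injective {r = r} {s} eq = F.toℕ-injective
  (trans (sym (values-rotation-zero r)) (trans (cong (λ π → values π F.zero) eq) (values-rotation-zero s)))

-- When K ≤ n ∸ i the subtraction i + K ∸ n truncates to 0 and neither side has an entry past its wrap point.
wrap-agrees : ∀ {K n i x} → i ≤ n → x < K → (x < n ∸ i) ⇔ (x < K ∸ (i + K ∸ n))
wrap-agrees {K} {n} {i} {x} i≤n x<K with K ≤? n ∸ i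
... | yes K≤n∸i = mk⇔ (λ _ → subst (x <_) (sym K∸r≡K) x<K) (λ _ → <-≤-trans x<K K≤n∸i)
  where
    K∸r≡K : K ∸ (i + K ∸ n) ≡ K
    K∸r≡K = cong (K ∸_) (m≤n⇒m∸n≡0 (subst (_≤ n) (+-comm K i) (m≤o∸n⇒m+n≤o K i≤n K≤n∸i)))
... | no  K≰n∸i = subst (λ t → (x < n ∸ i) ⇔ (x < t)) (sym K∸r≡n∸i) ⇔.refl
  where
    open ≡-Reasoning
    K∸r≡n∸i : K ∸ (i + K ∸ n) ≡ n ∸ i
    K∸r≡n∸i = begin
      K ∸ (i + K ∸ n)               ≡⟨ cong (λ v → K ∸ (i + K ∸ v)) (m+[n∸m]≡n i≤n) ⟨
      K ∸ (i + K ∸ (i + (n ∸ i)))   ≡⟨ cong (K ∸_) ([m+n]∸[m+o]≡n∸o i K (n ∸ i)) ⟩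
      K ∸ (K ∸ (n ∸ i))             ≡⟨ m∸[m∸n]≡n (<⇒≤ (≰⇒> K≰n∸i)) ⟩
      n ∸ i                         ∎

-- With r = i + K ∸ n both windows wrap after the same number n ∸ i of entries (or not at all).
identity-window≅rotation : ∀ {n k} .{{_ : NonZero n}} → suc k ≤ n → ∀ (i : Fin n) →
                           ∃ λ (r : Fin (suc k)) → OrderIsomorphic (window (identity n) i) (values (rotation r))
identity-window≅rotation {n} {k} K≤n i = r , λ a b →
  ⇔.trans (≡⇒<⇔< (window-identity a) (window-identity b))
  (⇔.trans (%-shift-≅ K≤n ≤-refl (<⇒≤ (F.toℕ<n i)) (<⇒≤ (F.toℕ<n r)) same-wrap (F.toℕ<n a) (F.toℕ<n b))
           (≡⇒<⇔< (sym (values-rotation r a)) (sym (values-rotation r b))))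
  where
    K = suc k
    r<K : toℕ i + K ∸ n < K
    r<K = m<n+o⇒m∸n<o (toℕ i + K) n (+-monoˡ-< K (F.toℕ<n i))
    r : Fin K
    r = fromℕ< r<K
    same-wrap : ∀ {x} → x < K → (x < n ∸ toℕ i) ⇔ (x < K ∸ toℕ r)
    same-wrap x<K =
      subst (λ t → _ ⇔ (_ < K ∸ t)) (sym (F.toℕ-fromℕ< r<K)) (wrap-agrees (<⇒≤ (F.toℕ<n i)) x<K)
    window-identity : ∀ a → window (identity n) i a ≡ (toℕ i + toℕ a) % n
    window-identity a = trans (cong toℕ (lookup-allFin (position i a))) (toℕ-position i a)

module _ (k : ℕ) where

  private
    K = suc k

  rotations : List (Perm K)
  rotations = L.tabulate rotation

  open DecMembership (_≟ₚ_ {K}) using (_∉?_)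

  nonRotations : List (Perm K)
  nonRotations = filter (_∉? rotations) (permutations K)

  nonRotations-isPatternSet : IsPatternSet K nonRotations
  nonRotations-isPatternSet =
    All.tabulate (λ π∈ → ∈-permutations⁻ K (proj₁ (∈-filter⁻ (_∉? rotations) {xs = permutations K} π∈))) ,
    filter⁺ (_∉? rotations) (permutations-unique K)

  length-nonRotations : length nonRotations ≡ K ! ∸ K
  length-nonRotations = begin
    length nonRotations                        ≡⟨ m+n∸n≡m (length nonRotations) K ⟨
    length nonRotations + K ∸ K                ≡⟨ cong (λ v → length nonRotations + v ∸ K) (length-tabulate rotation) ⟨
    length nonRotations + length rotations ∸ K ≡⟨ cong (_∸ K) (length-filter-∉+length _≟ₚ_
                                                     (permutations-unique K) (tabulate⁺ rotation-injective) rotations⊆perms) ⟩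
    length (permutations K) ∸ K                ≡⟨ cong (_∸ K) (length-permutations K) ⟩
    K ! ∸ K                                    ∎
    where
      open ≡-Reasoning
      rotations-perms : All IsPerm rotations
      rotations-perms = All.tabulate⁺ {f = rotation} rotation-isPerm
      rotations⊆perms : rotations ⊆ permutations K
      rotations⊆perms = ∈-permutations⁺ K ∘ All.lookup rotations-perms

  identity-avoids-nonRotations : ∀ {n} .{{_ : NonZero n}} → K ≤ n → CycAvoidsAll (identity n) nonRotations
  identity-avoids-nonRotations K≤n = All.tabulate λ {π} π∈ (i , π-occurs) →
    let π∈perms , π∉rotations = ∈-filter⁻ (_∉? rotations) {xs = permutations K} π∈
        r , window≅rotation = identity-window≅rotation K≤n i
    in π∉rotations (subst (_∈ rotations)
         (sym (isomorphic-perms-≡ π (rotation r) (∈-permutations⁻ K π∈perms) (rotation-isPerm r)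
                (≅-trans {x = values π} π-occurs window≅rotation)))
         (∈-tabulate⁺ {f = rotation} r))

  nonRotations-avoidable : Avoidable K nonRotations
  nonRotations-avoidable (N , unavoidable) =
    unavoidable n (m≤n⇒m≤1+n (m≤m+n N K)) K≤1+n (identity (suc n)) (identity-isPerm (suc n))
      (identity-avoids-nonRotations K≤1+n)
    where
      n = N + K
      K≤1+n = m≤n⇒m≤1+n (m≤n+m K N)

theorem7p1 : ∀ (k : ℕ) → k ≥ 1 →
    (∃ λ Π → IsPatternSet k Π × Avoidable k Π × length Π ≡ k ! ∸ k)
    × (∀ Π → IsPatternSet k Π → Avoidable k Π → length Π ≤ k ! ∸ k)
theorem7p1 (suc k) _ =
  (nonRotations k , nonRotations-isPatternSet k , nonRotations-avoidable k , length-nonRotations k) ,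
  λ Π Π-set Π-avoidable → Avoidable⇒length≤k!∸k Π-set Π-avoidable
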